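{- For all $n \ge 1$, if $I$ is a maximum size independent set of $H(n,3)$ and $I \cap D_n = \emptyset$, then $I = A_n$ or $I = A'_n$.
   Context: $H(n,3)$ is the Hamming graph on $\mathbb{Z}_3^n$ (vertices adjacent iff they differ in exactly one coordinate); a maximum size independent set is one of largest cardinality. $A_n = \{x \in \mathbb{Z}_3^n : \sum_{i=1}^n x_i \equiv 0 \pmod 3\}$ and $A'_n = \{x \in \mathbb{Z}_3^n : (\sum_{i=1}^{n-1} x_i) + 2x_n \equiv 0 \pmod 3\}$. For $S \subseteq \mathbb{Z}_3^{n}$ and $c \in \mathbb{Z}_3$, $(S,c) = \{(x_1,\dots,x_{n},c) : (x_1,\dots,x_n) \in S\}$. The sets $D_n$ are defined by $D_1 = \{1,2\}$ and $D_{n+1} = (D_n,0) \cup (A_n,1) \cup (A_n,2)$. -}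

module Defs where

open import Data.Nat using (ℕ; zero; suc; _+_; _*_; _%_; _≤_; _≥_)
open import Data.Fin using (Fin; toℕ; zero; suc)
open import Data.Fin.Properties using (_≟_)
open import Data.Vec using (Vec; []; _∷_; _∷ʳ_; init; last; foldr; zipWith; toList; tabulate)
open import Data.List using (List; []; _∷_; map; concatMap; length; filter)
open import Data.Bool using (Bool; true; false; if_then_else_; _∧_; _∨_; not; T)
open import Relation.Nullary.Decidable using (⌊_⌋)
open import Relation.Binary.PropositionalEquality using (_≡_)

Z3 : Set
Z3 = Fin 3

Point : ℕ → Set
Point n = Vec Z3 n

Subset : ℕ → Set
Subset n = Point n → Bool

hamming : ∀ {n} → Point n → Point n → ℕ
hamming [] [] = 0
hamming (x ∷ xs) (y ∷ ys) = (if ⌊ x ≟ y ⌋ then 0 else 1) + hamming xs ys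

Adjacent : ∀ {n} → Point n → Point n → Set
Adjacent x y = hamming x y ≡ 1

Independent : ∀ {n} → Subset n → Set
Independent {n} I = (x y : Point n) → T (I x) → T (I y) → Adjacent x y → ⊥'
  where open import Data.Empty renaming (⊥ to ⊥')

allFin3 : List Z3
allFin3 = zero ∷ suc zero ∷ suc (suc zero) ∷ []

allPoints : (n : ℕ) → List (Point n)
allPoints zero = [] ∷ []
allPoints (suc n) = concatMap (λ c → map (c ∷_) (allPoints n)) allFin3

card : ∀ {n} → Subset n → ℕ
card {n} S = length (filter (λ x → T? (S x)) (allPoints n))
  where
  open import Data.Bool.Properties using (T?)

MaxIndependent : ∀ {n} → Subset n → Set
MaxIndependent {n} I = Independent I × ((J : Subset n) → Independent J → card J ≤ card I)
  where open import Data.Product using (_×_)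

isZeroMod3 : ℕ → Bool
isZeroMod3 m = ⌊ m % 3 Data.Nat.≟ 0 ⌋
  where import Data.Nat

sumℕ : ∀ {n} → Point n → ℕ
sumℕ = foldr _ (λ x s → toℕ x + s) 0

A : (n : ℕ) → Subset n
A n x = isZeroMod3 (sumℕ x)

A' : (n : ℕ) → Subset (suc n)
A' n x = isZeroMod3 (sumℕ (init x) + 2 * toℕ (last x))

-- (S , c) : append coordinate c at the end; membership test for points of ℤ₃^(n+1)
appendSet : ∀ {n} → Subset n → Z3 → Subset (suc n)
appendSet S c x = ⌊ last x ≟ c ⌋ ∧ S (init x)

-- D_1 = {1,2},  D_{n+1} = (D_n,0) ∪ (A_n,1) ∪ (A_n,2);  D' k = D_{k+1}
D : (k : ℕ) → Subset (suc k)
D zero x = not ⌊ last x ≟ zero ⌋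
D (suc k) x = appendSet (D k) zero x ∨ appendSet (A (suc k)) (suc zero) x
                ∨ appendSet (A (suc k)) (suc (suc zero)) x

_≐_ : ∀ {n} → Subset n → Subset n → Set
_≐_ {n} S T' = (x : Point n) → S x ≡ T' x

module Submission where

-- Write Level r for the level set {x : x₁ + ⋯ + xₙ ≡ r in ℤ₃} (so A n = Level 0) and slice S c for
-- {y : (y , c) ∈ S}.  Slices of an independent set are independent, and distinct slices are disjoint
-- since (y , a) and (y , b) are adjacent; as any two points of H(1,3) are adjacent, induction gives
-- |I| ≤ 3ⁿ for independent I ⊆ ℤ₃ⁿ⁺¹, with equality for A.  So a maximum I has 3ⁿ points, and then
-- each of its slices has 3ⁿ⁻¹.
-- Key lemma: a maximum independent set J disjoint from some Level t is a level set.  By induction its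
-- slices are Level r_c with r_c ≠ t − c (they avoid the slices of Level t) and r₀, r₁, r₂ distinct,
-- which in ℤ₃ forces r_c = r₀ − c, i.e. J = Level r₀.
-- For n ≥ 2, D_n contains (A_{n-1},1) and (A_{n-1},2), so slices 1 and 2 of I are level sets with
-- distinct nonzero levels; slice 0 avoids slice 1, so it is a level set too, with the remaining level
-- 0.  The level sequences (0,2,1) and (0,1,2) are those of A_n and A'_n.  For n = 1, I is a single
-- point outside D_1 = {1,2}.

open import Defs
open import Data.Bool using (Bool; true; false; T; _∧_)
open import Data.Bool.Properties using (T?; T-≡; T-∧; T-∨) renaming (_≟_ to _≟ᵇ_)
open import Data.Empty using (⊥; ⊥-elim)
open import Data.Fin as Fin using (Fin; toℕ)
open import Data.Fin.Patterns using (0F; 1F; 2F)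
open import Data.Fin.Properties using (_≟_; all?; toℕ<n; toℕ-fromℕ<)
open import Data.List using (List; []; _∷_; _++_; map; concatMap; filter; length)
open import Data.List.Properties using (filter-++; length-++; map-cong)
open import Data.Nat as ℕ using (ℕ; zero; suc; _+_; _*_; _∸_; _%_; _^_; _≤_; z≤n)
open import Data.Nat.DivMod using (_mod_; %-distribˡ-+; m<n⇒m%n≡m)
open import Data.Nat.ListAction using () renaming (sum to sumˡ)
open import Data.Nat.Properties
  using (≤-refl; ≤-antisym; +-mono-≤; +-monoˡ-≤; +-monoʳ-≤; +-cancelʳ-≤; +-cancelˡ-≤; +-0-commutativeMonoid; module ≤-Reasoning)
open import Algebra.Properties.CommutativeMonoid.Sum +-0-commutativeMonoid using (sum; sum-syntax; sum-cong-≗; ∑-comm)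
open import Data.Product using (∃; _×_; _,_; proj₁; proj₂)
open import Data.Sum as Sum using (_⊎_; inj₁)
open import Data.Unit using (tt)
open import Data.Vec using ([]; _∷_; _∷ʳ_; foldr; replicate; initLast; lookup)
open import Data.Vec.Properties using (init-∷ʳ; last-∷ʳ; lookup∘tabulate)
open import Function using (id; _∘_)
open import Function.Bundles using (Equivalence)
open import Relation.Nullary.Decidable using (⌊_⌋; yes; no; from-yes; fromWitness; toWitness; ¬?; _→-dec_; _⊎-dec_)
open import Relation.Binary.PropositionalEquality
  using (_≡_; _≢_; _≗_; refl; sym; trans; cong; cong₂; subst; module ≡-Reasoning)

infixl 6 _⊕_ _⊖_

_⊕_ : Z3 → Z3 → Z3
a ⊕ b = (toℕ a + toℕ b) mod 3

_⊖_ : Z3 → Z3 → Z3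
a ⊖ b = (toℕ a + (3 ∸ toℕ b)) mod 3

⊕-assoc : ∀ a b c → a ⊕ (b ⊕ c) ≡ a ⊕ b ⊕ c
⊕-assoc = from-yes (all? λ a → all? λ b → all? λ c → a ⊕ (b ⊕ c) ≟ a ⊕ b ⊕ c)

⊕-comm : ∀ a b → a ⊕ b ≡ b ⊕ a
⊕-comm = from-yes (all? λ a → all? λ b → a ⊕ b ≟ b ⊕ a)

⊕-identityʳ : ∀ a → a ⊕ 0F ≡ a
⊕-identityʳ = from-yes (all? λ a → a ⊕ 0F ≟ a)

⊕-cancelˡ : ∀ a b c → a ⊕ b ≡ a ⊕ c → b ≡ c
⊕-cancelˡ = from-yes (all? λ a → all? λ b → all? λ c → a ⊕ b ≟ a ⊕ c →-dec b ≟ c)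

⊕-cancelʳ : ∀ a b c → b ⊕ a ≡ c ⊕ a → b ≡ c
⊕-cancelʳ = from-yes (all? λ a → all? λ b → all? λ c → b ⊕ a ≟ c ⊕ a →-dec b ≟ c)

⊕≟⇔≟⊖ : ∀ s c r → ⌊ s ⊕ c ≟ r ⌋ ≡ ⌊ s ≟ r ⊖ c ⌋
⊕≟⇔≟⊖ = from-yes (all? λ s → all? λ c → all? λ r → ⌊ s ⊕ c ≟ r ⌋ ≟ᵇ ⌊ s ≟ r ⊖ c ⌋)

%3-+ : ∀ m n {a b} → m % 3 ≡ toℕ a → n % 3 ≡ toℕ b → (m + n) % 3 ≡ toℕ (a ⊕ b)
%3-+ m n {a} {b} m≡a n≡b = begin
  (m + n) % 3             ≡⟨ %-distribˡ-+ m n 3 ⟩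
  (m % 3 + n % 3) % 3     ≡⟨ cong₂ (λ x y → (x + y) % 3) m≡a n≡b ⟩
  (toℕ a + toℕ b) % 3     ≡⟨ sym (toℕ-fromℕ< _) ⟩
  toℕ (a ⊕ b)             ∎
  where open ≡-Reasoning

sum₃ : ∀ {n} → Point n → Z3
sum₃ = foldr _ _⊕_ 0F

sum₃-∷ʳ : ∀ {n} (y : Point n) c → sum₃ (y ∷ʳ c) ≡ sum₃ y ⊕ c
sum₃-∷ʳ []      c = ⊕-comm c 0F
sum₃-∷ʳ (a ∷ y) c = trans (cong (a ⊕_) (sum₃-∷ʳ y c)) (⊕-assoc a (sum₃ y) c)

sum₃-replicate-0 : ∀ n → sum₃ (replicate n 0F) ≡ 0F
sum₃-replicate-0 zero    = refl
sum₃-replicate-0 (suc n) = cong (0F ⊕_) (sum₃-replicate-0 n)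

sumℕ-%3 : ∀ {n} (x : Point n) → sumℕ x % 3 ≡ toℕ (sum₃ x)
sumℕ-%3 []      = refl
sumℕ-%3 (a ∷ x) = %3-+ (toℕ a) (sumℕ x) (m<n⇒m%n≡m (toℕ<n a)) (sumℕ-%3 x)

Level : ∀ {n} → Z3 → Subset n
Level r x = ⌊ sum₃ x ≟ r ⌋

levelPoint : ∀ {m} → Z3 → Point (suc m)
levelPoint {m} r = r ∷ replicate m 0F

levelPoint∈Level : ∀ {m} r → T (Level r (levelPoint {m} r))
levelPoint∈Level {m} r = fromWitness (trans (cong (r ⊕_) (sum₃-replicate-0 m)) (⊕-identityʳ r))

slice : ∀ {n} → Subset (suc n) → Z3 → Subset n
slice S c y = S (y ∷ʳ c)

SliceLevels : ∀ {n} → Subset (suc n) → (Z3 → Z3) → Set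
SliceLevels S ρ = ∀ c → slice S c ≐ Level (ρ c)

≐-from-slices : ∀ {n} {S S′ : Subset (suc n)} → (∀ c → slice S c ≐ slice S′ c) → S ≐ S′
≐-from-slices e x with initLast x
... | y , c , refl = e c y

≐-from-SliceLevels : ∀ {n} {S S′ : Subset (suc n)} {ρ ρ′} → SliceLevels S ρ → SliceLevels S′ ρ′ → ρ ≗ ρ′ → S ≐ S′
≐-from-SliceLevels ρS ρS′ ρ≗ρ′ = ≐-from-slices λ c y →
  trans (ρS c y) (trans (cong (λ r → Level r y) (ρ≗ρ′ c)) (sym (ρS′ c y)))

Level-SliceLevels : ∀ {n} r → SliceLevels (Level {suc n} r) (r ⊖_)
Level-SliceLevels r c y = trans (cong (λ s → ⌊ s ≟ r ⌋) (sum₃-∷ʳ y c)) (⊕≟⇔≟⊖ (sum₃ y) c r)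

isZeroMod3-toℕ : ∀ m (a : Z3) → m % 3 ≡ toℕ a → isZeroMod3 m ≡ ⌊ a ≟ 0F ⌋
isZeroMod3-toℕ m 0F eq rewrite eq = refl
isZeroMod3-toℕ m 1F eq rewrite eq = refl
isZeroMod3-toℕ m 2F eq rewrite eq = refl

A≐Level0 : ∀ n → A n ≐ Level 0F
A≐Level0 n x = isZeroMod3-toℕ (sumℕ x) (sum₃ x) (sumℕ-%3 x)

A-SliceLevels : ∀ n → SliceLevels (A (suc n)) (0F ⊖_)
A-SliceLevels n c y = trans (A≐Level0 (suc n) (y ∷ʳ c)) (Level-SliceLevels 0F c y)

A'-SliceLevels : ∀ n → SliceLevels (A' n) id
A'-SliceLevels n c y rewrite init-∷ʳ c y | last-∷ʳ c y = begin
  isZeroMod3 (sumℕ y + 2 * toℕ c)  ≡⟨ isZeroMod3-toℕ (sumℕ y + 2 * toℕ c) _ sum-%3 ⟩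
  ⌊ sum₃ y ⊕ (c ⊕ c) ≟ 0F ⌋         ≡⟨ ⊕-double-≟0 (sum₃ y) c ⟩
  ⌊ sum₃ y ≟ c ⌋                    ∎
  where
  open ≡-Reasoning
  double-%3 : ∀ (c : Z3) → 2 * toℕ c % 3 ≡ toℕ (c ⊕ c)
  double-%3 = from-yes (all? λ c → 2 * toℕ c % 3 ℕ.≟ toℕ (c ⊕ c))
  ⊕-double-≟0 : ∀ (s c : Z3) → ⌊ s ⊕ (c ⊕ c) ≟ 0F ⌋ ≡ ⌊ s ≟ c ⌋
  ⊕-double-≟0 = from-yes (all? λ s → all? λ c → ⌊ s ⊕ (c ⊕ c) ≟ 0F ⌋ ≟ᵇ ⌊ s ≟ c ⌋)
  sum-%3 : (sumℕ y + 2 * toℕ c) % 3 ≡ toℕ (sum₃ y ⊕ (c ⊕ c))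
  sum-%3 = %3-+ (sumℕ y) (2 * toℕ c) (sumℕ-%3 y) (double-%3 c)

hamming-refl : ∀ {n} (x : Point n) → hamming x x ≡ 0
hamming-refl []      = refl
hamming-refl (a ∷ x) with a ≟ a
... | yes _  = hamming-refl x
... | no a≢a = ⊥-elim (a≢a refl)

hamming≡0⇒≡ : ∀ {n} (x y : Point n) → hamming x y ≡ 0 → x ≡ y
hamming≡0⇒≡ []      []      _ = refl
hamming≡0⇒≡ (a ∷ x) (b ∷ y) d with a ≟ b
... | yes refl = cong (a ∷_) (hamming≡0⇒≡ x y d)

hamming-∷ʳ : ∀ {n} (x y : Point n) a b → hamming (x ∷ʳ a) (y ∷ʳ b) ≡ hamming x y + hamming (a ∷ []) (b ∷ [])
hamming-∷ʳ []      []      a b = refl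
hamming-∷ʳ (u ∷ x) (v ∷ y) a b with u ≟ v
... | yes _ = hamming-∷ʳ x y a b
... | no  _ = cong suc (hamming-∷ʳ x y a b)

adjacent-∷ʳ : ∀ {n} {x y : Point n} c → Adjacent x y → Adjacent (x ∷ʳ c) (y ∷ʳ c)
adjacent-∷ʳ {x = x} {y} c adj = begin
  hamming (x ∷ʳ c) (y ∷ʳ c)               ≡⟨ hamming-∷ʳ x y c c ⟩
  hamming x y + hamming (c ∷ []) (c ∷ [])  ≡⟨ cong₂ _+_ adj (hamming-refl (c ∷ [])) ⟩
  1                                        ∎
  where open ≡-Reasoning

adjacent-last : ∀ {n} (y : Point n) {a b} → a ≢ b → Adjacent (y ∷ʳ a) (y ∷ʳ b)
adjacent-last y {a} {b} a≢b = trans (hamming-∷ʳ y y a b) (cong₂ _+_ (hamming-refl y) differ)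
  where
  differ : hamming (a ∷ []) (b ∷ []) ≡ 1
  differ with a ≟ b
  ... | yes a≡b = ⊥-elim (a≢b a≡b)
  ... | no  _   = refl

adjacent⇒sum₃-≢ : ∀ {n} (x y : Point n) → Adjacent x y → sum₃ x ≢ sum₃ y
adjacent⇒sum₃-≢ []      []      ()
adjacent⇒sum₃-≢ (a ∷ x) (b ∷ y) adj sums with a ≟ b
... | yes refl = adjacent⇒sum₃-≢ x y adj (⊕-cancelˡ a (sum₃ x) (sum₃ y) sums)
... | no  a≢b with refl ← hamming≡0⇒≡ x y (cong ℕ.pred adj) = a≢b (⊕-cancelʳ (sum₃ x) a b sums)

Disjoint : ∀ {n} → Subset n → Subset n → Set
Disjoint S S′ = ∀ x → T (S x) → T (S′ x) → ⊥

Level-independent : ∀ {n} r → Independent (Level {n} r)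
Level-independent r x y x∈ y∈ adj = adjacent⇒sum₃-≢ x y adj (trans (toWitness x∈) (sym (toWitness y∈)))

A-independent : ∀ n → Independent (A n)
A-independent n x y x∈ y∈ = Level-independent 0F x y (subst T (A≐Level0 n x) x∈) (subst T (A≐Level0 n y) y∈)

slice-independent : ∀ {n} {I : Subset (suc n)} → Independent I → ∀ c → Independent (slice I c)
slice-independent ind c x y x∈ y∈ adj = ind (x ∷ʳ c) (y ∷ʳ c) x∈ y∈ (adjacent-∷ʳ {x = x} {y} c adj)

slices-disjoint : ∀ {n} {I : Subset (suc n)} → Independent I → ∀ {a b} → a ≢ b → Disjoint (slice I a) (slice I b)
slices-disjoint ind a≢b y y∈ y∈′ = ind _ _ y∈ y∈′ (adjacent-last y a≢b)

disjoint-levels⇒≢ : ∀ {m} {S S′ : Subset (suc m)} {r s} → Disjoint S S′ → S ≐ Level r → S′ ≐ Level s → r ≢ s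
disjoint-levels⇒≢ {m} {r = r} disj e e′ refl =
  disj w (subst T (sym (e w)) (levelPoint∈Level {m} r)) (subst T (sym (e′ w)) (levelPoint∈Level {m} r))
  where w = levelPoint {m} r

Disjoint-≐ʳ : ∀ {n} {S S′ S″ : Subset n} → S′ ≐ S″ → Disjoint S S′ → Disjoint S S″
Disjoint-≐ʳ e disj x x∈S x∈S″ = disj x x∈S (subst T (sym (e x)) x∈S″)

slice-Disjoint-Level : ∀ {n} {J : Subset (suc n)} {t} → Disjoint J (Level t) → ∀ c → Disjoint (slice J c) (Level (t ⊖ c))
slice-Disjoint-Level {n} {t = t} avoid c = Disjoint-≐ʳ (Level-SliceLevels {n} t c) (λ y → avoid (y ∷ʳ c))

slice-levels-≢ : ∀ {m} {I : Subset (suc (suc m))} → Independent I → ∀ {a b r s} → a ≢ b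
               → slice I a ≐ Level r → slice I b ≐ Level s → r ≢ s
slice-levels-≢ ind a≢b = disjoint-levels⇒≢ (slices-disjoint ind a≢b)

count : ∀ {A : Set} → (A → Bool) → List A → ℕ
count p xs = length (filter (T? ∘ p) xs)

count-++ : ∀ {A : Set} (p : A → Bool) xs ys → count p (xs ++ ys) ≡ count p xs + count p ys
count-++ p xs ys = trans (cong length (filter-++ (T? ∘ p) xs ys)) (length-++ (filter (T? ∘ p) xs))

count-map : ∀ {A B : Set} (p : B → Bool) (f : A → B) xs → count p (map f xs) ≡ count (p ∘ f) xs
count-map p f []       = refl
count-map p f (x ∷ xs) with p (f x)
... | true  = cong suc (count-map p f xs)
... | false = count-map p f xs

count-concatMap : ∀ {A B : Set} (p : B → Bool) (f : A → List B) xs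
                → count p (concatMap f xs) ≡ sumˡ (map (count p ∘ f) xs)
count-concatMap p f []       = refl
count-concatMap p f (x ∷ xs) = trans (count-++ p (f x) (concatMap f xs)) (cong (count p (f x) +_) (count-concatMap p f xs))

count-cong : ∀ {A : Set} {p q : A → Bool} → p ≗ q → ∀ xs → count p xs ≡ count q xs
count-cong         p≗q []       = refl
count-cong {p = p} {q} p≗q (x ∷ xs) with p x | q x | p≗q x
... | true  | .true  | refl = cong suc (count-cong p≗q xs)
... | false | .false | refl = count-cong p≗q xs

card-cong : ∀ {n} {S S′ : Subset n} → S ≐ S′ → card S ≡ card S′
card-cong {n} e = count-cong e (allPoints n)

card-∷-slices : ∀ {n} (S : Subset (suc n)) → card S ≡ ∑[ c < 3 ] card (S ∘ (c ∷_))
card-∷-slices {n} S = trans (count-concatMap S (λ c → map (c ∷_) (allPoints n)) allFin3)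
  (cong sumˡ (map-cong (λ c → count-map S (c ∷_) (allPoints n)) allFin3))

card-slices : ∀ {n} (S : Subset (suc n)) → card S ≡ ∑[ c < 3 ] card (slice S c)
card-slices {zero}  S = trans (card-∷-slices S) (sum-cong-≗ λ c → card-cong {S = S ∘ (c ∷_)} {slice S c} λ { [] → refl })
card-slices {suc n} S = begin
  card S                                              ≡⟨ card-∷-slices S ⟩
  ∑[ a < 3 ] card (S ∘ (a ∷_))                         ≡⟨ sum-cong-≗ (λ a → card-slices (S ∘ (a ∷_))) ⟩
  ∑[ a < 3 ] ∑[ c < 3 ] card (slice (S ∘ (a ∷_)) c)    ≡⟨ ∑-comm (λ a c → card (slice (S ∘ (a ∷_)) c)) ⟩
  ∑[ c < 3 ] ∑[ a < 3 ] card (slice S c ∘ (a ∷_))      ≡⟨ sum-cong-≗ (λ c → sym (card-∷-slices (slice S c))) ⟩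
  ∑[ c < 3 ] card (slice S c)                          ∎
  where open ≡-Reasoning

sum-mono-≤ : ∀ {n} {f g : Fin n → ℕ} → (∀ i → f i ≤ g i) → sum f ≤ sum g
sum-mono-≤ {zero}  f≤g = z≤n
sum-mono-≤ {suc n} f≤g = +-mono-≤ (f≤g 0F) (sum-mono-≤ (f≤g ∘ Fin.suc))

+-tight : ∀ {a b m n} → a ≤ m → b ≤ n → a + b ≡ m + n → a ≡ m × b ≡ n
+-tight {a} {b} {m} {n} a≤m b≤n eq =
  ≤-antisym a≤m (+-cancelʳ-≤ n m a (begin m + n ≡⟨ sym eq ⟩ a + b ≤⟨ +-monoʳ-≤ a b≤n ⟩ a + n ∎)) ,
  ≤-antisym b≤n (+-cancelˡ-≤ m n b (begin m + n ≡⟨ sym eq ⟩ a + b ≤⟨ +-monoˡ-≤ b a≤m ⟩ m + b ∎))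
  where open ≤-Reasoning

sum-tight : ∀ {n} {f g : Fin n → ℕ} → (∀ i → f i ≤ g i) → sum f ≡ sum g → ∀ i → f i ≡ g i
sum-tight {suc n} f≤g eq with +-tight (f≤g 0F) (sum-mono-≤ (f≤g ∘ Fin.suc)) eq
... | head≡ , tail≡ = λ { 0F → head≡ ; (Fin.suc i) → sum-tight (f≤g ∘ Fin.suc) tail≡ i }

card-Level : ∀ m r → card (Level {suc m} r) ≡ 3 ^ m
card-Level zero    0F = refl
card-Level zero    1F = refl
card-Level zero    2F = refl
card-Level (suc m) r  = trans (card-slices (Level {suc (suc m)} r))
  (sum-cong-≗ λ c → trans (card-cong (Level-SliceLevels {suc m} r c)) (card-Level m (r ⊖ c)))

-- Exposes the three values of S, which `filter` would otherwise hide from `with`-abstraction.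
card₁ : (S : Subset 1) → card S ≡ count id (S (0F ∷ []) ∷ S (1F ∷ []) ∷ S (2F ∷ []) ∷ [])
card₁ S = sym (count-map id S (allPoints 1))

independent₁-card≤1 : (I : Subset 1) → Independent I → card I ≤ 1
independent₁-card≤1 I ind rewrite card₁ I with I (0F ∷ []) in e₀ | I (1F ∷ []) in e₁ | I (2F ∷ []) in e₂
... | false | false | false = z≤n
... | true  | false | false = ≤-refl
... | false | true  | false = ≤-refl
... | false | false | true  = ≤-refl
... | true  | true  | _     = ⊥-elim (ind _ _ (Equivalence.from T-≡ e₀) (Equivalence.from T-≡ e₁) refl)
... | true  | false | true  = ⊥-elim (ind _ _ (Equivalence.from T-≡ e₀) (Equivalence.from T-≡ e₂) refl)
... | false | true  | true  = ⊥-elim (ind _ _ (Equivalence.from T-≡ e₁) (Equivalence.from T-≡ e₂) refl)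

independent-card≤ : ∀ m (I : Subset (suc m)) → Independent I → card I ≤ 3 ^ m
independent-card≤ zero    I ind = independent₁-card≤1 I ind
independent-card≤ (suc m) I ind = begin
  card I                         ≡⟨ card-slices I ⟩
  ∑[ c < 3 ] card (slice I c)    ≤⟨ sum-mono-≤ (λ c → independent-card≤ m (slice I c) (slice-independent ind c)) ⟩
  3 ^ suc m                      ∎
  where open ≤-Reasoning

Maximum : ∀ m → Subset (suc m) → Set
Maximum m I = Independent I × card I ≡ 3 ^ m

MaxIndependent⇒Maximum : ∀ m {I : Subset (suc m)} → MaxIndependent I → Maximum m I
MaxIndependent⇒Maximum m {I} (ind , maximal) = ind , ≤-antisym (independent-card≤ m I ind) (begin
  3 ^ m                   ≡⟨ sym (card-Level m 0F) ⟩
  card (Level {suc m} 0F) ≡⟨ card-cong (λ x → sym (A≐Level0 (suc m) x)) ⟩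
  card (A (suc m))        ≤⟨ maximal (A (suc m)) (A-independent (suc m)) ⟩
  card I                  ∎)
  where open ≤-Reasoning

Maximum-slice : ∀ {m} {I : Subset (suc (suc m))} → Maximum (suc m) I → ∀ c → Maximum m (slice I c)
Maximum-slice {m} {I} (ind , full) c = slice-independent ind c , sum-tight bound (trans (sym (card-slices I)) full) c
  where
  bound : ∀ c → card (slice I c) ≤ 3 ^ m
  bound c = independent-card≤ m (slice I c) (slice-independent ind c)

card≡1⇒Level : (J : Subset 1) → card J ≡ 1 → ∃ λ r → J ≐ Level r
card≡1⇒Level J one with J (0F ∷ []) in e₀ | J (1F ∷ []) in e₁ | J (2F ∷ []) in e₂ | trans (sym (card₁ J)) one
card≡1⇒Level J _ | false | false | false | ()
card≡1⇒Level J _ | true  | false | false | _ = 0F , λ { (0F ∷ []) → e₀ ; (1F ∷ []) → e₁ ; (2F ∷ []) → e₂ }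
card≡1⇒Level J _ | false | true  | false | _ = 1F , λ { (0F ∷ []) → e₀ ; (1F ∷ []) → e₁ ; (2F ∷ []) → e₂ }
card≡1⇒Level J _ | false | false | true | _ = 2F , λ { (0F ∷ []) → e₀ ; (1F ∷ []) → e₁ ; (2F ∷ []) → e₂ }
card≡1⇒Level J _ | true  | true  | _ | ()
card≡1⇒Level J _ | true  | false | true | ()
card≡1⇒Level J _ | false | true  | true | ()

antidiagonal : ∀ t r₀ r₁ r₂ → r₀ ≢ r₁ → r₀ ≢ r₂ → r₁ ≢ r₂ → r₀ ≢ t ⊖ 0F → r₁ ≢ t ⊖ 1F → r₂ ≢ t ⊖ 2F
             → lookup (r₀ ∷ r₁ ∷ r₂ ∷ []) ≗ r₀ ⊖_
antidiagonal = from-yes (all? λ t → all? λ r₀ → all? λ r₁ → all? λ r₂ →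
  ¬? (r₀ ≟ r₁) →-dec ¬? (r₀ ≟ r₂) →-dec ¬? (r₁ ≟ r₂) →-dec
  ¬? (r₀ ≟ t ⊖ 0F) →-dec ¬? (r₁ ≟ t ⊖ 1F) →-dec ¬? (r₂ ≟ t ⊖ 2F) →-dec
  all? λ c → lookup (r₀ ∷ r₁ ∷ r₂ ∷ []) c ≟ r₀ ⊖ c)

Maximum-avoiding-Level⇒Level : ∀ m {t} (J : Subset (suc m)) → Maximum m J → Disjoint J (Level t) → ∃ λ r → J ≐ Level r
Maximum-avoiding-Level⇒Level zero    J (_ , one) _ = card≡1⇒Level J one
Maximum-avoiding-Level⇒Level (suc m) {t} J F@(ind , _) avoid =
  r 0F , ≐-from-SliceLevels (proj₂ ∘ level) (Level-SliceLevels (r 0F)) λ c →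
    trans (sym (lookup∘tabulate r c))
          (antidiagonal t (r 0F) (r 1F) (r 2F) (distinct (λ ())) (distinct (λ ())) (distinct (λ ()))
                        (avoids 0F) (avoids 1F) (avoids 2F) c)
  where
  level : ∀ c → ∃ λ r → slice J c ≐ Level r
  level c = Maximum-avoiding-Level⇒Level m (slice J c) (Maximum-slice F c) (slice-Disjoint-Level avoid c)
  r : Z3 → Z3
  r = proj₁ ∘ level
  distinct : ∀ {a b} → a ≢ b → r a ≢ r b
  distinct a≢b = slice-levels-≢ ind a≢b (proj₂ (level _)) (proj₂ (level _))
  avoids : ∀ c → r c ≢ t ⊖ c
  avoids c = disjoint-levels⇒≢ (slice-Disjoint-Level avoid c) (proj₂ (level c)) (λ _ → refl)

levels-avoiding-0 : ∀ r₀ r₁ r₂ → r₀ ≢ r₁ → r₀ ≢ r₂ → r₁ ≢ r₂ → r₁ ≢ 0F → r₂ ≢ 0F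
                  → lookup (r₀ ∷ r₁ ∷ r₂ ∷ []) ≗ 0F ⊖_ ⊎ lookup (r₀ ∷ r₁ ∷ r₂ ∷ []) ≗ id
levels-avoiding-0 = from-yes (all? λ r₀ → all? λ r₁ → all? λ r₂ →
  ¬? (r₀ ≟ r₁) →-dec ¬? (r₀ ≟ r₂) →-dec ¬? (r₁ ≟ r₂) →-dec ¬? (r₁ ≟ 0F) →-dec ¬? (r₂ ≟ 0F) →-dec
  ((all? λ c → lookup (r₀ ∷ r₁ ∷ r₂ ∷ []) c ≟ 0F ⊖ c) ⊎-dec (all? λ c → lookup (r₀ ∷ r₁ ∷ r₂ ∷ []) c ≟ c)))

Maximum-avoiding-Level0-slices⇒A⊎A' : ∀ k {I : Subset (suc (suc k))} → Maximum (suc k) I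
  → Disjoint (slice I 1F) (Level 0F) → Disjoint (slice I 2F) (Level 0F)
  → I ≐ A (suc (suc k)) ⊎ I ≐ A' (suc k)
Maximum-avoiding-Level0-slices⇒A⊎A' k {I} F@(ind , _) avoid₁ avoid₂ =
  Sum.map (≐-from-SliceLevels levels (A-SliceLevels (suc k))) (≐-from-SliceLevels levels (A'-SliceLevels (suc k)))
    (levels-avoiding-0 r₀ r₁ r₂
      (slice-levels-≢ ind (λ ()) e₀ e₁) (slice-levels-≢ ind (λ ()) e₀ e₂) (slice-levels-≢ ind (λ ()) e₁ e₂)
      (disjoint-levels⇒≢ avoid₁ e₁ (λ _ → refl)) (disjoint-levels⇒≢ avoid₂ e₂ (λ _ → refl)))
  where
  level₁ = Maximum-avoiding-Level⇒Level k (slice I 1F) (Maximum-slice F 1F) avoid₁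
  level₂ = Maximum-avoiding-Level⇒Level k (slice I 2F) (Maximum-slice F 2F) avoid₂
  r₁ = proj₁ level₁
  r₂ = proj₁ level₂
  e₁ = proj₂ level₁
  e₂ = proj₂ level₂
  level₀ = Maximum-avoiding-Level⇒Level k (slice I 0F) (Maximum-slice F 0F) (Disjoint-≐ʳ e₁ (slices-disjoint ind (λ ())))
  r₀ = proj₁ level₀
  e₀ = proj₂ level₀
  levels : SliceLevels I (lookup (r₀ ∷ r₁ ∷ r₂ ∷ []))
  levels 0F = e₀
  levels 1F = e₁
  levels 2F = e₂

A⊆D-slice : ∀ k c → c ≢ 0F → ∀ y → T (A (suc k) y) → T (D (suc k) (y ∷ʳ c))
A⊆D-slice k 0F c≢0 y y∈A = ⊥-elim (c≢0 refl)
A⊆D-slice k 1F _   y y∈A rewrite init-∷ʳ 1F y | last-∷ʳ 1F y = Equivalence.from T-∨ (inj₁ y∈A)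
A⊆D-slice k 2F _   y y∈A rewrite init-∷ʳ 2F y | last-∷ʳ 2F y = y∈A

Disjoint-D⇒slice-Disjoint-Level0 : ∀ k {I : Subset (suc (suc k))} → Disjoint I (D (suc k))
                                 → ∀ c → c ≢ 0F → Disjoint (slice I c) (Level 0F)
Disjoint-D⇒slice-Disjoint-Level0 k avoid c c≢0 y y∈I y∈L =
  avoid (y ∷ʳ c) y∈I (A⊆D-slice k c c≢0 y (subst T (sym (A≐Level0 (suc k) y)) y∈L))

Maximum-avoiding-D⇒A⊎A' : ∀ k {I : Subset (suc k)} → Maximum k I → Disjoint I (D k) → I ≐ A (suc k) ⊎ I ≐ A' k
Maximum-avoiding-D⇒A⊎A' zero {I} (_ , one) avoid with card≡1⇒Level I one
... | 0F , e = inj₁ λ x → trans (e x) (sym (A≐Level0 1 x))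
... | 1F , e = ⊥-elim (avoid (1F ∷ []) (subst T (sym (e (1F ∷ []))) tt) tt)
... | 2F , e = ⊥-elim (avoid (2F ∷ []) (subst T (sym (e (2F ∷ []))) tt) tt)
Maximum-avoiding-D⇒A⊎A' (suc k) F avoid =
  Maximum-avoiding-Level0-slices⇒A⊎A' k F (slices-avoid 1F (λ ())) (slices-avoid 2F (λ ()))
  where slices-avoid = Disjoint-D⇒slice-Disjoint-Level0 k avoid

proposition3p7 : (k : ℕ) → (I : Subset (suc k)) → MaxIndependent I
               → ((x : Point (suc k)) → T (I x ∧ D k x) → ⊥)
               → (I ≐ A (suc k)) ⊎ (I ≐ A' k)
proposition3p7 k I max avoidsD =
  Maximum-avoiding-D⇒A⊎A' k (MaxIndependent⇒Maximum k max)
    (λ x x∈I x∈D → avoidsD x (Equivalence.from T-∧ (x∈I , x∈D)))
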